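{- Let $m$ be a nonnegative integer and let $G$ be a graph on $n=|V(G)|$ vertices that has at least $m+1$ independent edges. Then the $(n-m)$-dominating graph $D_{n-m}(G)$ is connected.
   Context: All graphs are finite, simple and undirected. A set $S\subseteq V(G)$ is a dominating set of $G$ if every vertex of $V(G)\setminus S$ is adjacent to a vertex of $S$. A set of edges is independent if no two of them share an endpoint. For a positive integer $k$, the $k$-dominating graph $D_k(G)$ is the graph whose vertices are the dominating sets of $G$ of cardinality at most $k$, where two such sets $A,B$ are adjacent if and only if their symmetric difference $(A\setminus B)\cup(B\setminus A)$ consists of exactly one vertex of $G$. -}

module Defs where

open import Data.Nat using (ℕ; suc; _≤_)
open import Data.Fin using (Fin)
open import Data.Fin.Subset using (Subset; _∈_; ∣_∣)
open import Data.Vec using (lookup)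
open import Data.Bool using (Bool)
open import Data.Product using (Σ; ∃; _×_)
open import Data.Sum using (_⊎_)
open import Relation.Nullary using (¬_)
open import Relation.Binary.PropositionalEquality using (_≡_; _≢_)
open import Level using (0ℓ) renaming (suc to lsuc)

record Graph (n : ℕ) : Set₁ where
  field
    Adj    : Fin n → Fin n → Set
    sym    : ∀ {u v} → Adj u v → Adj v u
    irrefl : ∀ {u} → ¬ Adj u u
open Graph public

Dominating : ∀ {n} → Graph n → Subset n → Set
Dominating {n} G S = ∀ (v : Fin n) → v ∈ S ⊎ (∃ λ u → u ∈ S × Adj G u v)

HasIndependentEdges : ∀ {n} → Graph n → ℕ → Set
HasIndependentEdges {n} G k =
  Σ (Fin k → Fin n) λ u → Σ (Fin k → Fin n) λ v →
    (∀ i → Adj G (u i) (v i)) ×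
    (∀ i j → i ≢ j →
       (u i ≢ u j) × (u i ≢ v j) × (v i ≢ u j) × (v i ≢ v j))

IsDkVertex : ∀ {n} → Graph n → ℕ → Subset n → Set
IsDkVertex G k S = Dominating G S × ∣ S ∣ ≤ k

-- Adjacency in D_k(G): symmetric difference is exactly one vertex,
-- i.e. A and B differ in exactly one coordinate.
DkAdj : ∀ {n} → Subset n → Subset n → Set
DkAdj {n} A B = ∃ λ (x : Fin n) →
  (lookup A x ≢ lookup B x) × (∀ y → y ≢ x → lookup A y ≡ lookup B y)

data Walk {n} (G : Graph n) (k : ℕ) : Subset n → Subset n → Set where
  here : ∀ {A} → Walk G k A A
  step : ∀ {A B C} → IsDkVertex G k B → DkAdj A B → Walk G k B C → Walk G k A C

DkConnected : ∀ {n} → Graph n → ℕ → Set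
DkConnected {n} G k =
  (∃ λ (S : Subset n) → IsDkVertex G k S) ×
  (∀ A B → IsDkVertex G k A → IsDkVertex G k B → Walk G k A B)

-- Let u j — v j (j ≤ m) be the independent edges and let T be the complement of
-- {u 0, …, u m}. Every vertex outside T is some u j, dominated by v j ∈ T, and
-- |T| ≤ n − m − 1, so T is a vertex of D_{n−m}(G); it suffices to walk from every vertex A
-- of D_{n−m}(G) to T. Greedily: if |A| = n − m, the complement of A has at most m
-- vertices, and counting private neighbours shows that one endpoint of some edge u j v j ⊆ A
-- can be dropped from A keeping it dominating. Otherwise, add an unmatched vertex missing
-- from A, or v j for an edge disjoint from A; once A contains every unmatched vertex and
-- meets every edge, it is dominated through those edges, and each u j ∈ A can be traded for
-- v j. A potential (unmatched vertices missing from A, plus a weight on the two sides of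
-- each edge) strictly decreases along the way, so the walk reaches T.

module Submission where

open import Data.Bool using (not)
open import Data.Fin using (Fin; zero; suc; splitAt; join)
open import Data.Fin.Properties
  using (_≟_; any?; all?; ¬∀⟶∃¬; splitAt-join; join-splitAt; punchInᵢ≢i; 0≢1+n; suc-injective)
open import Data.Fin.Subset using (Subset; Side; inside; outside; _∈_; _∉_; _⊆_; _⊂_; ∁; ∣_∣)
open import Data.Fin.Subset.Properties
  using (_∈?_; p⊂q⇒∣p∣<∣q∣; ∣p∣≤n; ∣∁p∣≡n∸∣p∣; x∉p⇒x∈∁p; ⊆-antisym)
open import Data.Maybe using (Maybe; just; nothing)
open import Data.Maybe.Properties using (just-injective; ≡-dec)
open import Data.Nat using (ℕ; zero; suc; _+_; _∸_; _≤_; _<_; z≤n; s≤s; _≤?_)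
open import Data.Nat.Induction using (<-wellFounded)
open import Data.Nat.Properties
  using ( ≤-refl; ≤-trans; ≤-reflexive; <⇒≤; <⇒≱; ≰⇒>; n≤1+n; +-comm; +-monoʳ-≤; +-monoˡ-<; +-mono-<
        ; +-mono-<-≤; +-mono-≤-<; m≤n+m∸n; m≤n+o⇒m∸n≤o; m+n≤o⇒m≤o∸n; m≤o∸n⇒m+n≤o
        ; +-0-commutativeMonoid; module ≤-Reasoning )
open import Algebra.Properties.CommutativeMonoid.Sum +-0-commutativeMonoid using (sum; sum-cong-≗; sum-remove)
open import Data.Product as Prod using (Σ; ∃; _×_; _,_; proj₁; proj₂; -,_)
open import Data.Sum as Sum using (_⊎_; inj₁; inj₂; [_,_]′; swap)
open import Data.Sum.Properties using (inj₁-injective; inj₂-injective; swap-involutive)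
open import Data.Vec using ([]; _∷_; _++_; lookup; _[_]≔_; tabulate)
open import Data.Vec.Functional using (removeAt)
open import Data.Vec.Properties
  using ( []=⇒lookup; lookup⇒[]=; []=-injective; []≔-updates; []≔-minimal; lookup∘update; lookup∘update′
        ; lookup-++ˡ; lookup-++ʳ; lookup∘tabulate )
open import Defs hiding (sym)
open import Function using (_∘_; id; const; flip; Injective)
open import Induction.WellFounded using (Acc; acc)
open import Relation.Binary.Core using (_⇒_)
open import Relation.Binary.Definitions using (Decidable; Symmetric)
open import Relation.Binary.PropositionalEquality
open import Relation.Nullary using (¬_; Dec; yes; no; contradiction)
open import Relation.Nullary.Decidable
  using (_×-dec_; _⊎-dec_; ¬?; does; dec-true; dec-false; decidable-stable)

private
  variable
    n r : ℕ
    p q : Subset n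
    x y : Fin n

∈-update⁻ : y ≢ x → ∀ s → y ∈ p [ x ]≔ s → y ∈ p
∈-update⁻ {p = p} y≢x s y∈ = lookup⇒[]= _ p (trans (sym (lookup∘update′ y≢x p s)) ([]=⇒lookup y∈))

∈-update⁺ : y ≢ x → ∀ s → y ∈ p → y ∈ p [ x ]≔ s
∈-update⁺ {p = p} y≢x s = []≔-minimal p _ _ y≢x

x∉p[x]≔outside : ∀ (p : Subset n) x → x ∉ p [ x ]≔ outside
x∉p[x]≔outside p x x∈ with () ← []=-injective ([]≔-updates p x) x∈

p⊆p[x]≔inside : ∀ (p : Subset n) x → p ⊆ p [ x ]≔ inside
p⊆p[x]≔inside p x {y} y∈p with y ≟ x
... | yes refl = []≔-updates p x
... | no y≢x   = ∈-update⁺ y≢x inside y∈p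

p[x]≔outside⊂p : x ∈ p → p [ x ]≔ outside ⊂ p
p[x]≔outside⊂p {x = x} {p = p} x∈p =
  (λ {y} y∈ → ∈-update⁻ (λ { refl → x∉p[x]≔outside p x y∈ }) outside y∈) ,
  x , x∈p , x∉p[x]≔outside p x

∣p[x]≔outside∣<∣p∣ : x ∈ p → ∣ p [ x ]≔ outside ∣ < ∣ p ∣
∣p[x]≔outside∣<∣p∣ = p⊂q⇒∣p∣<∣q∣ ∘ p[x]≔outside⊂p

∣p[x]≔inside∣≤1+∣p∣ : ∀ (p : Subset n) x → ∣ p [ x ]≔ inside ∣ ≤ suc ∣ p ∣
∣p[x]≔inside∣≤1+∣p∣ (outside ∷ p) zero    = ≤-refl
∣p[x]≔inside∣≤1+∣p∣ (inside  ∷ p) zero    = n≤1+n _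
∣p[x]≔inside∣≤1+∣p∣ (outside ∷ p) (suc x) = ∣p[x]≔inside∣≤1+∣p∣ p x
∣p[x]≔inside∣≤1+∣p∣ (inside  ∷ p) (suc x) = s≤s (∣p[x]≔inside∣≤1+∣p∣ p x)

∉⇒lookup≡outside : x ∉ p → lookup p x ≡ outside
∉⇒lookup≡outside {x = x} {p = p} x∉p with lookup p x in eq
... | inside  = contradiction (lookup⇒[]= x p eq) x∉p
... | outside = refl

∣∁p∣≤m : ∀ {m} {p : Subset n} → n ∸ m ≤ ∣ p ∣ → ∣ ∁ p ∣ ≤ m
∣∁p∣≤m {n} {m} {p} n∸m≤∣p∣ = begin
  ∣ ∁ p ∣   ≡⟨ ∣∁p∣≡n∸∣p∣ p ⟩
  n ∸ ∣ p ∣ ≤⟨ m≤n+o⇒m∸n≤o n ∣ p ∣ n≤∣p∣+m ⟩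
  m         ∎
  where
  open ≤-Reasoning
  n≤∣p∣+m : n ≤ ∣ p ∣ + m
  n≤∣p∣+m = begin
    n           ≤⟨ m≤n+m∸n n m ⟩
    m + (n ∸ m) ≤⟨ +-monoʳ-≤ m n∸m≤∣p∣ ⟩
    m + ∣ p ∣   ≡⟨ +-comm m ∣ p ∣ ⟩
    ∣ p ∣ + m   ∎

∣p∣≤n∸m : ∀ {m} {p : Subset n} → m < ∣ ∁ p ∣ → ∣ p ∣ ≤ n ∸ m
∣p∣≤n∸m {n} {m} {p} m<∣∁p∣ = m+n≤o⇒m≤o∸n ∣ p ∣ (begin
  ∣ p ∣ + m     ≡⟨ +-comm ∣ p ∣ m ⟩
  m + ∣ p ∣     <⟨ m≤o∸n⇒m+n≤o (suc m) (∣p∣≤n p) (subst (m <_) (∣∁p∣≡n∸∣p∣ p) m<∣∁p∣) ⟩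
  n             ∎)
  where open ≤-Reasoning

injection-bound : (f : Fin r → Fin n) → Injective _≡_ _≡_ f → (∀ i → f i ∈ p) → r ≤ ∣ p ∣
injection-bound {zero}          f f-inj f∈p = z≤n
injection-bound {suc r} {p = p} f f-inj f∈p = begin
  suc r                         ≤⟨ s≤s (injection-bound (f ∘ suc) (suc-injective ∘ f-inj) f∘suc∈p′) ⟩
  suc ∣ p [ f zero ]≔ outside ∣ ≤⟨ ∣p[x]≔outside∣<∣p∣ (f∈p zero) ⟩
  ∣ p ∣                         ∎
  where
  open ≤-Reasoning
  f∘suc∈p′ : ∀ i → f (suc i) ∈ p [ f zero ]≔ outside
  f∘suc∈p′ i = ∈-update⁺ (0≢1+n ∘ sym ∘ f-inj) outside (f∈p (suc i))

∣p++q∣≡∣p∣+∣q∣ : ∀ {m} (p : Subset m) (q : Subset n) → ∣ p ++ q ∣ ≡ ∣ p ∣ + ∣ q ∣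
∣p++q∣≡∣p∣+∣q∣ []            q = refl
∣p++q∣≡∣p∣+∣q∣ (outside ∷ p) q = ∣p++q∣≡∣p∣+∣q∣ p q
∣p++q∣≡∣p∣+∣q∣ (inside  ∷ p) q = cong suc (∣p++q∣≡∣p∣+∣q∣ p q)

join-∈-++ : ∀ {m} {p : Subset m} {q : Subset n} c → [ _∈ p , _∈ q ]′ c → join m n c ∈ p ++ q
join-∈-++ {p = p} {q} (inj₁ x) x∈p = lookup⇒[]= _ (p ++ q) (trans (lookup-++ˡ p q x) ([]=⇒lookup x∈p))
join-∈-++ {p = p} {q} (inj₂ x) x∈q = lookup⇒[]= _ (p ++ q) (trans (lookup-++ʳ p q x) ([]=⇒lookup x∈q))

injection-bound-⊎ : (f : Fin r → Fin n ⊎ Fin n) → Injective _≡_ _≡_ f →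
                    (∀ i → [ _∈ p , _∈ q ]′ (f i)) → r ≤ ∣ p ∣ + ∣ q ∣
injection-bound-⊎ {n = n} {p = p} {q} f f-inj f∈ =
  subst (_ ≤_) (∣p++q∣≡∣p∣+∣q∣ p q)
    (injection-bound (join n n ∘ f) (f-inj ∘ join-injective) (λ i → join-∈-++ (f i) (f∈ i)))
  where
  join-injective : Injective _≡_ _≡_ (join n n)
  join-injective {c} {c′} eq = trans (sym (splitAt-join n n c)) (trans (cong (splitAt n) eq) (splitAt-join n n c′))

sum-<-at : ∀ (f g : Fin n → ℕ) i → f i < g i → (∀ j → j ≢ i → f j ≡ g j) → sum f < sum g
sum-<-at {suc n} f g i fᵢ<gᵢ f≡g = begin-strict
  sum f                    ≡⟨ sum-remove {i = i} f ⟩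
  f i + sum (removeAt f i) <⟨ +-monoˡ-< _ fᵢ<gᵢ ⟩
  g i + sum (removeAt f i) ≡⟨ cong (g i +_) (sum-cong-≗ (λ j → f≡g _ (punchInᵢ≢i i j))) ⟩
  g i + sum (removeAt g i) ≡⟨ sum-remove {i = i} g ⟨
  sum g                    ∎
  where open ≤-Reasoning

update-DkAdj : ∀ (p : Subset n) x s → lookup p x ≢ s → DkAdj p (p [ x ]≔ s)
update-DkAdj p x s pₓ≢s =
  x , (λ eq → pₓ≢s (trans eq (lookup∘update x p s))) , (λ y y≢x → sym (lookup∘update′ y≢x p s))

insert-DkAdj : x ∉ p → DkAdj p (p [ x ]≔ inside)
insert-DkAdj {p = p} x∉p = update-DkAdj p _ inside (x∉p ∘ lookup⇒[]= _ p)

remove-DkAdj : x ∈ p → DkAdj p (p [ x ]≔ outside)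
remove-DkAdj {p = p} x∈p = update-DkAdj p _ outside (λ eq → contradiction (trans (sym ([]=⇒lookup x∈p)) eq) λ ())

DkAdj-sym : DkAdj p q → DkAdj q p
DkAdj-sym (x , pₓ≢qₓ , p≡q) = x , pₓ≢qₓ ∘ sym , λ y y≢x → sym (p≡q y y≢x)

module _ {G : Graph n} {k : ℕ} where

  infixr 5 _◅◅_

  _◅◅_ : ∀ {A B C} → Walk G k A B → Walk G k B C → Walk G k A C
  here            ◅◅ w′ = w′
  step vB A~B w   ◅◅ w′ = step vB A~B (w ◅◅ w′)

  reverse : ∀ {A B} → IsDkVertex G k A → Walk G k A B → Walk G k B A
  reverse vA here            = here
  reverse {A} vA (step {B = B} vB A~B w) = reverse vB w ◅◅ step vA (DkAdj-sym {p = A} {B} A~B) here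

module _ (E : Fin n → Fin n → Set) where

  DominatedBy : Subset n → Fin n → Set
  DominatedBy S y = y ∈ S ⊎ ∃ λ x → x ∈ S × E x y

  DominatingVia : Subset n → Set
  DominatingVia S = ∀ y → DominatedBy S y

  PrivateNeighbour : Subset n → Fin n → Fin n → Set
  PrivateNeighbour S x y = y ∉ S × E x y × (∀ a → a ∈ S → E a y → a ≡ x)

module _ {E : Fin n → Fin n → Set} where

  dominatedBy? : Decidable E → ∀ S y → Dec (DominatedBy E S y)
  dominatedBy? E? S y = (y ∈? S) ⊎-dec any? (λ x → (x ∈? S) ×-dec E? x y)

  dominatingVia? : Decidable E → ∀ S → Dec (DominatingVia E S)
  dominatingVia? E? S = all? (dominatedBy? E? S)

  dominatingVia-⊆ : p ⊆ q → DominatingVia E p → DominatingVia E q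
  dominatingVia-⊆ p⊆q dom = Sum.map p⊆q (Prod.map₂ (Prod.map₁ p⊆q)) ∘ dom

  dominatingVia⇒dominating : {G : Graph n} → E ⇒ Adj G → DominatingVia E p → Dominating G p
  dominatingVia⇒dominating E⇒G dom = Sum.map id (Prod.map₂ (Prod.map₂ E⇒G)) ∘ dom

  private-neighbour : ∀ {S o} → Decidable E → DominatingVia E S → x ∈ S → o ∈ S → o ≢ x → E o x →
                      ¬ DominatingVia E (S [ x ]≔ outside) → ∃ (PrivateNeighbour E S x)
  private-neighbour {x = x} {S} {o} E? dom x∈S o∈S o≢x Eox undominating
    with y , y-undominated ← ¬∀⟶∃¬ _ _ (dominatedBy? E? (S [ x ]≔ outside)) undominating
    = y , y∉S , Exy , unique
    where
    y≢x : y ≢ x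
    y≢x refl = y-undominated (inj₂ (o , ∈-update⁺ o≢x outside o∈S , Eox))
    y∉S : y ∉ S
    y∉S y∈S = y-undominated (inj₁ (∈-update⁺ y≢x outside y∈S))
    unique : ∀ a → a ∈ S → E a y → a ≡ x
    unique a a∈S Eay with a ≟ x
    ... | yes a≡x = a≡x
    ... | no  a≢x = contradiction (inj₂ (a , ∈-update⁺ a≢x outside a∈S , Eay)) y-undominated
    Exy : E x y
    Exy with dom y
    ... | inj₁ y∈S             = contradiction y∈S y∉S
    ... | inj₂ (a , a∈S , Eay) = subst (λ a → E a y) (unique a a∈S Eay) Eay

-- Adj G is an arbitrary family of types, so the classical steps (finding an undominated
-- vertex, or a removable one) are carried out in a decidable spanning subgraph.
record DecSubgraph (G : Graph n) : Set₁ where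
  field
    Edge     : Fin n → Fin n → Set
    edge?    : Decidable Edge
    edge-sym : Symmetric Edge
    edge⇒adj : Edge ⇒ Adj G

symmetric-closure : {G : Graph n} (R : Fin n → Fin n → Set) → Decidable R → R ⇒ Adj G → DecSubgraph G
symmetric-closure {G = G} R R? R⇒G = record
  { Edge     = λ x y → R x y ⊎ R y x
  ; edge?    = λ x y → R? x y ⊎-dec R? y x
  ; edge-sym = swap
  ; edge⇒adj = [ R⇒G , Graph.sym G ∘ R⇒G ]′
  }

dominating-subgraph : {G : Graph n} (R : Fin n → Fin n → Set) → Decidable R → R ⇒ Adj G → Dominating G p →
  Σ (DecSubgraph G) λ H → R ⇒ DecSubgraph.Edge H × DominatingVia (DecSubgraph.Edge H) p
dominating-subgraph {n} {p} {G} R R? R⇒G dom =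
  symmetric-closure R′ (λ x y → R? x y ⊎-dec witnessed? x y) [ R⇒G , witness-adj ]′ ,
  inj₁ ∘ inj₁ ,
  λ y → Sum.map id (Prod.map₂ (Prod.map₂ (inj₁ ∘ inj₂))) (witness-dominates (dom y))
  where
  witness : ∀ {y} → y ∈ p ⊎ ∃ (λ x → x ∈ p × Adj G x y) → Maybe (Fin n)
  witness = [ const nothing , just ∘ proj₁ ]′
  Witnessed : Fin n → Fin n → Set
  Witnessed x y = witness (dom y) ≡ just x
  witnessed? : Decidable Witnessed
  witnessed? x y = ≡-dec _≟_ (witness (dom y)) (just x)
  witness-adj : Witnessed ⇒ Adj G
  witness-adj {x} {y} eq with dom y
  ... | inj₂ (_ , _ , adj) = subst (λ a → Adj G a y) (just-injective eq) adj
  R′ : Fin n → Fin n → Set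
  R′ x y = R x y ⊎ Witnessed x y
  witness-dominates : ∀ {y} (d : y ∈ p ⊎ ∃ (λ x → x ∈ p × Adj G x y)) → y ∈ p ⊎ ∃ λ x → x ∈ p × witness d ≡ just x
  witness-dominates (inj₁ y∈p)           = inj₁ y∈p
  witness-dominates (inj₂ (x , x∈p , _)) = inj₂ (x , x∈p , refl)

module Matching {n m} (G : Graph n) (u v : Fin (suc m) → Fin n) (uv-adj : ∀ j → Adj G (u j) (v j))
  (independent : ∀ i j → i ≢ j → (u i ≢ u j) × (u i ≢ v j) × (v i ≢ u j) × (v i ≢ v j)) where

  k : ℕ
  k = n ∸ m

  Endpoint : Set
  Endpoint = Fin (suc m) ⊎ Fin (suc m)

  end : Endpoint → Fin n
  end = [ u , v ]′

  u≢v : ∀ j → u j ≢ v j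
  u≢v j uⱼ≡vⱼ = irrefl G (subst (Adj G (u j)) (sym uⱼ≡vⱼ) (uv-adj j))

  end-injective : Injective _≡_ _≡_ end
  end-injective {inj₁ i} {inj₁ j} eq with i ≟ j
  ... | yes refl = refl
  ... | no  i≢j  = contradiction eq (proj₁ (independent i j i≢j))
  end-injective {inj₁ i} {inj₂ j} eq with i ≟ j
  ... | yes refl = contradiction eq (u≢v i)
  ... | no  i≢j  = contradiction eq (proj₁ (proj₂ (independent i j i≢j)))
  end-injective {inj₂ i} {inj₁ j} eq with i ≟ j
  ... | yes refl = contradiction (sym eq) (u≢v i)
  ... | no  i≢j  = contradiction eq (proj₁ (proj₂ (proj₂ (independent i j i≢j))))
  end-injective {inj₂ i} {inj₂ j} eq with i ≟ j
  ... | yes refl = refl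
  ... | no  i≢j  = contradiction eq (proj₂ (proj₂ (proj₂ (independent i j i≢j))))

  end-≢ : ∀ e e′ → e ≢ e′ → end e ≢ end e′
  end-≢ _ _ e≢e′ = e≢e′ ∘ end-injective

  mate≢end : ∀ e → end (swap e) ≢ end e
  mate≢end (inj₁ j) = end-≢ (inj₂ j) (inj₁ j) λ ()
  mate≢end (inj₂ j) = end-≢ (inj₁ j) (inj₂ j) λ ()

  Unmatched : Fin n → Set
  Unmatched y = ∀ e → y ≢ end e

  unmatched-or-end : ∀ y → Unmatched y ⊎ ∃ λ e → y ≡ end e
  unmatched-or-end y with any? (λ j → y ≟ u j) | any? (λ j → y ≟ v j)
  ... | yes (j , y≡uⱼ) | _                = inj₂ (inj₁ j , y≡uⱼ)
  ... | no _           | yes (j , y≡vⱼ)   = inj₂ (inj₂ j , y≡vⱼ)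
  ... | no y∉u         | no y∉v           = inj₁ λ where
    (inj₁ j) y≡uⱼ → y∉u (j , y≡uⱼ)
    (inj₂ j) y≡vⱼ → y∉v (j , y≡vⱼ)

  unmatched? : ∀ y → Dec (Unmatched y)
  unmatched? y = [ yes , (λ (e , y≡end) → no λ un → un e y≡end) ]′ (unmatched-or-end y)

  u-image? : ∀ y → Dec (∃ λ j → y ≡ u j)
  u-image? y = any? λ j → y ≟ u j

  target : Subset n
  target = tabulate (not ∘ does ∘ u-image?)

  lookup-target : ∀ y → lookup target y ≡ not (does (u-image? y))
  lookup-target = lookup∘tabulate (not ∘ does ∘ u-image?)

  ∈target : (∀ j → y ≢ u j) → y ∈ target
  ∈target {y} y≢u = lookup⇒[]= y target
    (trans (lookup-target y) (cong not (dec-false (u-image? y) λ (j , y≡uⱼ) → y≢u j y≡uⱼ)))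

  u∉target : ∀ j → u j ∉ target
  u∉target j uⱼ∈target with () ← trans (sym ([]=⇒lookup uⱼ∈target))
                                   (trans (lookup-target (u j)) (cong not (dec-true (u-image? (u j)) (j , refl))))

  v∈target : ∀ j → v j ∈ target
  v∈target j = ∈target λ i → end-≢ (inj₂ j) (inj₁ i) λ ()

  target-dominating : Dominating G target
  target-dominating y with u-image? y
  ... | no  y∉u        = inj₁ (∈target λ j y≡uⱼ → y∉u (j , y≡uⱼ))
  ... | yes (j , refl) = inj₂ (v j , v∈target j , Graph.sym G (uv-adj j))

  ∣target∣≤k : ∣ target ∣ ≤ k
  ∣target∣≤k = ∣p∣≤n∸m {p = target}
    (injection-bound u (inj₁-injective ∘ end-injective) (x∉p⇒x∈∁p ∘ u∉target))

  outsideWeight : Side → ℕ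
  outsideWeight inside  = 0
  outsideWeight outside = 1

  -- Every move of the walk towards the target changes the sides of one matching edge uv as
  -- ●● ↦ ○●, ●● ↦ ●○, ○○ ↦ ○● or ●○ ↦ ○● (● = inside), and each of these lowers this weight.
  pairWeight : Side → Side → ℕ
  pairWeight inside  inside  = 2
  pairWeight inside  outside = 1
  pairWeight outside outside = 1
  pairWeight outside inside  = 0

  missing : Subset n → Fin n → ℕ
  missing A y with unmatched? y
  ... | yes _ = outsideWeight (lookup A y)
  ... | no  _ = 0

  edgeWeight : Subset n → Fin (suc m) → ℕ
  edgeWeight A j = pairWeight (lookup A (u j)) (lookup A (v j))

  μ : Subset n → ℕ
  μ A = sum (missing A) + sum (edgeWeight A)

  missing-cong : ∀ {A A′} y → (Unmatched y → lookup A′ y ≡ lookup A y) → missing A′ y ≡ missing A y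
  missing-cong y A′≡A with unmatched? y
  ... | yes un = cong outsideWeight (A′≡A un)
  ... | no  _  = refl

  μ-vertex-move : ∀ {A A′} → Unmatched y → y ∉ A → y ∈ A′ → (∀ z → z ≢ y → lookup A′ z ≡ lookup A z) →
                  μ A′ < μ A
  μ-vertex-move {y} {A} {A′} un y∉A y∈A′ A′≡A =
    +-mono-<-≤ (sum-<-at _ _ y missing-< (λ z z≢y → missing-cong z λ _ → A′≡A z z≢y))
               (≤-reflexive (sum-cong-≗ λ j → cong₂ pairWeight (A′≡A (u j) (un (inj₁ j) ∘ sym))
                                                                (A′≡A (v j) (un (inj₂ j) ∘ sym))))
    where
    missing-< : missing A′ y < missing A y
    missing-< with unmatched? y
    ... | no ¬un = contradiction un ¬un
    ... | yes _ rewrite []=⇒lookup y∈A′ | ∉⇒lookup≡outside y∉A = s≤s z≤n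

  μ-edge-move : ∀ {A A′} j → (∀ z → z ≢ u j → z ≢ v j → lookup A′ z ≡ lookup A z) →
                edgeWeight A′ j < edgeWeight A j → μ A′ < μ A
  μ-edge-move j A′≡A weight-< =
    +-mono-≤-< (≤-reflexive (sum-cong-≗ λ y → missing-cong y λ un → A′≡A y (un (inj₁ j)) (un (inj₂ j))))
               (sum-<-at _ _ j weight-< λ i i≢j → cong₂ pairWeight
                 (A′≡A (u i) (end-≢ (inj₁ i) (inj₁ j) (i≢j ∘ inj₁-injective)) (end-≢ (inj₁ i) (inj₂ j) λ ()))
                 (A′≡A (v i) (end-≢ (inj₂ i) (inj₁ j) λ ()) (end-≢ (inj₂ i) (inj₂ j) (i≢j ∘ inj₂-injective))))

  edgeWeight-< : ∀ A A′ j {a b a′ b′} → lookup A′ (u j) ≡ a′ → lookup A′ (v j) ≡ b′ →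
                 lookup A (u j) ≡ a → lookup A (v j) ≡ b → pairWeight a′ b′ < pairWeight a b →
                 edgeWeight A′ j < edgeWeight A j
  edgeWeight-< A A′ j refl refl refl refl lt = lt

  μ-remove-end : ∀ {A} e → end e ∈ A → end (swap e) ∈ A → μ (A [ end e ]≔ outside) < μ A
  μ-remove-end {A} (inj₁ j) u∈A v∈A = μ-edge-move j (λ z z≢u _ → lookup∘update′ z≢u A outside)
    (edgeWeight-< A (A [ u j ]≔ outside) j
                  (lookup∘update (u j) A outside)
                  (trans (lookup∘update′ (u≢v j ∘ sym) A outside) ([]=⇒lookup v∈A))
                  ([]=⇒lookup u∈A) ([]=⇒lookup v∈A) (s≤s z≤n))
  μ-remove-end {A} (inj₂ j) v∈A u∈A = μ-edge-move j (λ z _ z≢v → lookup∘update′ z≢v A outside)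
    (edgeWeight-< A (A [ v j ]≔ outside) j
                  (trans (lookup∘update′ (u≢v j) A outside) ([]=⇒lookup u∈A))
                  (lookup∘update (v j) A outside)
                  ([]=⇒lookup u∈A) ([]=⇒lookup v∈A) (s≤s (s≤s z≤n)))

  μ-insert-unmatched : ∀ {A} → Unmatched y → y ∉ A → μ (A [ y ]≔ inside) < μ A
  μ-insert-unmatched {y} {A} un y∉A =
    μ-vertex-move un y∉A ([]≔-updates A y) (λ z z≢y → lookup∘update′ z≢y A inside)

  μ-insert-v : ∀ {A} j → u j ∉ A → v j ∉ A → μ (A [ v j ]≔ inside) < μ A
  μ-insert-v {A} j u∉A v∉A = μ-edge-move j (λ z _ z≢v → lookup∘update′ z≢v A inside)
    (edgeWeight-< A (A [ v j ]≔ inside) j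
                  (trans (lookup∘update′ (u≢v j) A inside) (∉⇒lookup≡outside u∉A))
                  (lookup∘update (v j) A inside)
                  (∉⇒lookup≡outside u∉A) (∉⇒lookup≡outside v∉A) (s≤s z≤n))

  μ-shift : ∀ {A} j → u j ∈ A → v j ∉ A → μ ((A [ v j ]≔ inside) [ u j ]≔ outside) < μ A
  μ-shift {A} j u∈A v∉A = μ-edge-move j (λ z z≢u z≢v → trans (lookup∘update′ z≢u A₁ outside) (lookup∘update′ z≢v A inside))
    (edgeWeight-< A (A₁ [ u j ]≔ outside) j
                  (lookup∘update (u j) A₁ outside)
                  (trans (lookup∘update′ (u≢v j ∘ sym) A₁ outside) (lookup∘update (v j) A inside))
                  ([]=⇒lookup u∈A) (∉⇒lookup≡outside v∉A) (s≤s z≤n))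
    where
    A₁ : Subset n
    A₁ = A [ v j ]≔ inside

  module ViaSubgraph (H : DecSubgraph G) (matched : ∀ j → DecSubgraph.Edge H (u j) (v j)) where

    open DecSubgraph H

    mate-edge : ∀ e → Edge (end (swap e)) (end e)
    mate-edge (inj₁ j) = edge-sym (matched j)
    mate-edge (inj₂ j) = matched j

    Admissible : Subset n → Set
    Admissible S = DominatingVia Edge S × ∣ S ∣ ≤ k

    admissible⇒vertex : ∀ {S} → Admissible S → IsDkVertex G k S
    admissible⇒vertex (dom , size) = dominatingVia⇒dominating {G = G} edge⇒adj dom , size

    insert-admissible : ∀ {A} → ∣ A ∣ < k → DominatingVia Edge A → Admissible (A [ x ]≔ inside)
    insert-admissible {x} {A} small dom =
      dominatingVia-⊆ (p⊆p[x]≔inside A x) dom , ≤-trans (∣p[x]≔inside∣≤1+∣p∣ A x) small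

    remove-admissible : ∀ {A} → x ∈ A → ∣ A ∣ ≤ k → DominatingVia Edge (A [ x ]≔ outside) →
                        Admissible (A [ x ]≔ outside)
    remove-admissible x∈A size dom = dom , ≤-trans (<⇒≤ (∣p[x]≔outside∣<∣p∣ x∈A)) size

    insert-walk : ∀ {A} → x ∉ A → Admissible (A [ x ]≔ inside) → Walk G k A (A [ x ]≔ inside)
    insert-walk x∉A adm = step (admissible⇒vertex adm) (insert-DkAdj x∉A) here

    remove-walk : ∀ {A} → x ∈ A → Admissible (A [ x ]≔ outside) → Walk G k A (A [ x ]≔ outside)
    remove-walk x∈A adm = step (admissible⇒vertex adm) (remove-DkAdj x∈A) here

    record Progress (A : Subset n) : Set where
      constructor progress
      field
        {next}     : Subset n
        admissible : Admissible next
        decreases  : μ next < μ A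
        walk       : Walk G k A next

    insert-progress : ∀ {A} → x ∉ A → ∣ A ∣ < k → DominatingVia Edge A → μ (A [ x ]≔ inside) < μ A → Progress A
    insert-progress {x} {A} x∉A small dom decreases = progress adm decreases (insert-walk x∉A adm)
      where
      adm : Admissible (A [ x ]≔ inside)
      adm = insert-admissible small dom

    remove-progress : ∀ {A} → x ∈ A → ∣ A ∣ ≤ k → DominatingVia Edge (A [ x ]≔ outside) →
                      μ (A [ x ]≔ outside) < μ A → Progress A
    remove-progress {x} {A} x∈A size dom decreases = progress adm decreases (remove-walk x∈A adm)
      where
      adm : Admissible (A [ x ]≔ outside)
      adm = remove-admissible x∈A size dom

    Covers : Subset n → Set
    Covers S = (∀ y → Unmatched y → y ∈ S) × (∀ j → u j ∈ S ⊎ v j ∈ S)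

    covers-⊆ : p ⊆ q → Covers p → Covers q
    covers-⊆ p⊆q (unmatched⊆p , covered) = (λ y → p⊆q ∘ unmatched⊆p y) , Sum.map p⊆q p⊆q ∘ covered

    covers-without-u : ∀ {A} j → Covers A → v j ∈ A → Covers (A [ u j ]≔ outside)
    covers-without-u {A} j (unmatched⊆A , covered) v∈A =
      (λ y un → ∈-update⁺ (un (inj₁ j)) outside (unmatched⊆A y un)) , covered′
      where
      covered′ : ∀ i → u i ∈ A [ u j ]≔ outside ⊎ v i ∈ A [ u j ]≔ outside
      covered′ i with i ≟ j
      ... | yes refl = inj₂ (∈-update⁺ (u≢v j ∘ sym) outside v∈A)
      ... | no  i≢j  = Sum.map (∈-update⁺ (proj₁ (independent i j i≢j)) outside)
                               (∈-update⁺ (proj₁ (proj₂ (proj₂ (independent i j i≢j)))) outside)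
                               (covered i)

    covers⇒dominatingVia : ∀ {S} → Covers S → DominatingVia Edge S
    covers⇒dominatingVia {S} (unmatched⊆S , covered) y with y ∈? S | unmatched-or-end y
    ... | yes y∈S | _                = inj₁ y∈S
    ... | no  y∉S | inj₁ un          = contradiction (unmatched⊆S y un) y∉S
    ... | no  y∉S | inj₂ (e , refl)  = inj₂ (end (swap e) , mate∈ e y∉S , mate-edge e)
      where
      mate∈ : ∀ e → end e ∉ S → end (swap e) ∈ S
      mate∈ (inj₁ j) u∉S = [ flip contradiction u∉S , id ]′ (covered j)
      mate∈ (inj₂ j) v∉S = [ id , flip contradiction v∉S ]′ (covered j)

    covers⇒≡target : ∀ {A} → Covers A → (∀ j → u j ∉ A) → A ≡ target
    covers⇒≡target {A} (unmatched⊆A , covered) u∉A = ⊆-antisym A⊆target target⊆A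
      where
      A⊆target : A ⊆ target
      A⊆target y∈A = ∈target λ { j refl → u∉A j y∈A }
      target⊆A : target ⊆ A
      target⊆A {y} y∈target with unmatched-or-end y
      ... | inj₁ un               = unmatched⊆A y un
      ... | inj₂ (inj₁ j , refl)  = contradiction y∈target (u∉target j)
      ... | inj₂ (inj₂ j , refl)  = [ flip contradiction (u∉A j) , id ]′ (covered j)

    Removable : Subset n → Endpoint → Set
    Removable A e = end e ∈ A × end (swap e) ∈ A × DominatingVia Edge (A [ end e ]≔ outside)

    removable? : ∀ A e → Dec (Removable A e)
    removable? A e = (end e ∈? A) ×-dec (end (swap e) ∈? A) ×-dec dominatingVia? edge? _

    data Charge (A : Subset n) (e : Endpoint) : Fin n ⊎ Fin n → Set where
      end-outside    : y ≡ end e → y ∉ A → Charge A e (inj₁ y)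
      mate-outside   : y ≡ end (swap e) → end e ∈ A → y ∉ A → Charge A e (inj₂ y)
      private-to-end : end e ∈ A → PrivateNeighbour Edge A (end e) y → Charge A e (inj₂ y)

    charge : ∀ {A} → DominatingVia Edge A → ∀ e → ¬ Removable A e → ∃ (Charge A e)
    charge {A} dom e unremovable with end e ∈? A | end (swap e) ∈? A
    ... | no  e∉A | _       = -, end-outside refl e∉A
    ... | yes e∈A | no  m∉A = -, mate-outside refl e∈A m∉A
    ... | yes e∈A | yes m∈A = -, private-to-end e∈A
      (proj₂ (private-neighbour edge? dom e∈A m∈A (mate≢end e) (mate-edge e) (unremovable ∘ (e∈A ,_) ∘ (m∈A ,_))))

    charge-injective : ∀ {A e e′ c} → Charge A e c → Charge A e′ c → e ≡ e′
    charge-injective (end-outside refl _) (end-outside eq _) = end-injective eq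
    charge-injective (mate-outside refl _ _) (mate-outside eq _ _) = swap-injective (end-injective eq)
      where
      swap-injective : ∀ {e e′ : Endpoint} → swap e ≡ swap e′ → e ≡ e′
      swap-injective {e} {e′} eq = trans (sym (swap-involutive e)) (trans (cong swap eq) (swap-involutive e′))
    charge-injective {e = e} (mate-outside refl e∈A _) (private-to-end _ (_ , _ , unique)) =
      end-injective (unique (end e) e∈A (edge-sym (mate-edge e)))
    charge-injective {e′ = e′} (private-to-end _ (_ , _ , unique)) (mate-outside refl e′∈A _) =
      sym (end-injective (unique (end e′) e′∈A (edge-sym (mate-edge e′))))
    charge-injective {e = e} (private-to-end e∈A (_ , Ey , _)) (private-to-end _ (_ , _ , unique′)) =
      end-injective (unique′ (end e) e∈A Ey)

    charge∈∁ : ∀ {A e c} → Charge A e c → [ _∈ ∁ A , _∈ ∁ A ]′ c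
    charge∈∁ (end-outside _ y∉A)          = x∉p⇒x∈∁p y∉A
    charge∈∁ (mate-outside _ _ y∉A)       = x∉p⇒x∈∁p y∉A
    charge∈∁ (private-to-end _ (y∉A , _)) = x∉p⇒x∈∁p y∉A

    -- Unless some endpoint is removable, the 2(m+1) endpoints charge distinct vertices of
    -- two copies of the complement, which has at most m elements when |A| ≥ n - m.
    removable-exists : ∀ {A} → DominatingVia Edge A → k ≤ ∣ A ∣ → ∃ (Removable A)
    removable-exists {A} dom full with any? (removable? A ∘ splitAt (suc m))
    ... | yes (i , removable) = splitAt (suc m) i , removable
    ... | no  none            = contradiction charges-distinct (<⇒≱ (+-mono-< (s≤s few) (s≤s few)))
      where
      few : ∣ ∁ A ∣ ≤ m
      few = ∣∁p∣≤m {p = A} full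
      unremovable : ∀ e → ¬ Removable A e
      unremovable e removable =
        none (join (suc m) (suc m) e , subst (Removable A) (sym (splitAt-join (suc m) (suc m) e)) removable)
      charge-of : ∀ i → ∃ (Charge A (splitAt (suc m) i))
      charge-of i = charge dom (splitAt (suc m) i) (unremovable (splitAt (suc m) i))
      charges-distinct : suc m + suc m ≤ ∣ ∁ A ∣ + ∣ ∁ A ∣
      charges-distinct = injection-bound-⊎ (proj₁ ∘ charge-of) injective (charge∈∁ ∘ proj₂ ∘ charge-of)
        where
        injective : Injective _≡_ _≡_ (proj₁ ∘ charge-of)
        injective {i} {i′} eq = begin
          i                           ≡⟨ join-splitAt (suc m) (suc m) i ⟨
          join (suc m) (suc m) (splitAt (suc m) i)  ≡⟨ cong (join (suc m) (suc m)) (charge-injective (proj₂ (charge-of i)) (subst (Charge A _) (sym eq) (proj₂ (charge-of i′)))) ⟩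
          join (suc m) (suc m) (splitAt (suc m) i′) ≡⟨ join-splitAt (suc m) (suc m) i′ ⟩
          i′                          ∎
          where open ≡-Reasoning

    uncovered-or-covers : ∀ A → (∃ λ y → Unmatched y × y ∉ A) ⊎ (∃ λ j → u j ∉ A × v j ∉ A) ⊎ Covers A
    uncovered-or-covers A
      with any? (λ y → unmatched? y ×-dec ¬? (y ∈? A)) | any? (λ j → ¬? (u j ∈? A) ×-dec ¬? (v j ∈? A))
    ... | yes missed | _        = inj₁ missed
    ... | no  _      | yes bare = inj₂ (inj₁ bare)
    ... | no  ¬missed | no ¬bare = inj₂ (inj₂ (unmatched⊆A , covered))
      where
      unmatched⊆A : ∀ y → Unmatched y → y ∈ A
      unmatched⊆A y un = decidable-stable (y ∈? A) λ y∉A → ¬missed (y , un , y∉A)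
      covered : ∀ j → u j ∈ A ⊎ v j ∈ A
      covered j with u j ∈? A | v j ∈? A
      ... | yes u∈A | _       = inj₁ u∈A
      ... | no  _   | yes v∈A = inj₂ v∈A
      ... | no  u∉A | no  v∉A = contradiction (j , u∉A , v∉A) ¬bare

    shift-progress : ∀ {A} j → Covers A → ∣ A ∣ < k → u j ∈ A → v j ∉ A → Progress A
    shift-progress {A} j cov small u∈A v∉A =
      progress adm₂ (μ-shift j u∈A v∉A) (insert-walk v∉A adm₁ ◅◅ remove-walk u∈A₁ adm₂)
      where
      A₁ : Subset n
      A₁ = A [ v j ]≔ inside
      u∈A₁ : u j ∈ A₁
      u∈A₁ = p⊆p[x]≔inside A (v j) u∈A
      adm₁ : Admissible A₁
      adm₁ = insert-admissible small (covers⇒dominatingVia cov)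
      adm₂ : Admissible (A₁ [ u j ]≔ outside)
      adm₂ = remove-admissible u∈A₁ (proj₂ adm₁)
        (covers⇒dominatingVia (covers-without-u j (covers-⊆ (p⊆p[x]≔inside A (v j)) cov) ([]≔-updates A (v j))))

    covered-step : ∀ {A} → Covers A → ∣ A ∣ < k → A ≡ target ⊎ Progress A
    covered-step {A} cov small with any? (λ j → u j ∈? A)
    ... | no  none         = inj₁ (covers⇒≡target cov λ j u∈A → none (j , u∈A))
    ... | yes (j , u∈A) with v j ∈? A
    ...   | yes v∈A = inj₂ (remove-progress u∈A (<⇒≤ small)
                              (covers⇒dominatingVia (covers-without-u j cov v∈A)) (μ-remove-end (inj₁ j) u∈A v∈A))
    ...   | no  v∉A = inj₂ (shift-progress j cov small u∈A v∉A)

    step-to-target : ∀ {A} → Admissible A → A ≡ target ⊎ Progress A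
    step-to-target {A} (dom , size) with k ≤? ∣ A ∣
    ... | yes full with e , e∈A , mate∈A , dom′ ← removable-exists dom full =
      inj₂ (remove-progress e∈A size dom′ (μ-remove-end e e∈A mate∈A))
    ... | no  ¬full with uncovered-or-covers A
    ...   | inj₁ (y , un , y∉A)        = inj₂ (insert-progress y∉A (≰⇒> ¬full) dom (μ-insert-unmatched un y∉A))
    ...   | inj₂ (inj₁ (j , u∉A , v∉A)) = inj₂ (insert-progress v∉A (≰⇒> ¬full) dom (μ-insert-v j u∉A v∉A))
    ...   | inj₂ (inj₂ cov)            = covered-step cov (≰⇒> ¬full)

    admissible-walk : ∀ A → Acc _<_ (μ A) → Admissible A → Walk G k A target
    admissible-walk A (acc smaller) adm with step-to-target adm
    ... | inj₁ refl                        = here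
    ... | inj₂ (progress adm′ decreases w) = w ◅◅ admissible-walk _ (smaller decreases) adm′

  Matched : Fin n → Fin n → Set
  Matched x y = ∃ λ j → x ≡ u j × y ≡ v j

  matched? : Decidable Matched
  matched? x y = any? λ j → (x ≟ u j) ×-dec (y ≟ v j)

  matched⇒adj : Matched ⇒ Adj G
  matched⇒adj (j , refl , refl) = uv-adj j

  walk-to-target : ∀ {A} → IsDkVertex G k A → Walk G k A target
  walk-to-target {A} (dom , size) with H , matched⇒H , domH ← dominating-subgraph Matched matched? matched⇒adj dom =
    ViaSubgraph.admissible-walk H (λ j → matched⇒H (j , refl , refl)) A (<-wellFounded (μ A)) (domH , size)

theorem1 : (m n : ℕ) (G : Graph n) → HasIndependentEdges G (suc m) → DkConnected G (n ∸ m)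
theorem1 m n G (u , v , uv-adj , independent) =
  (target , target-dominating , ∣target∣≤k) ,
  λ A B A-vertex B-vertex → walk-to-target A-vertex ◅◅ reverse B-vertex (walk-to-target B-vertex)
  where open Matching G u v uv-adj independent
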